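{- (1) If $\vdash P:\bigwedge_{i\in I}\mathsf p?\ell_i(S_i).T_i$, then $P=\sum_{i\in I'}\mathsf p?\ell_i(x).P_i$ for some index set $I'\supseteq I$ and processes $P_i$. (2) If $\vdash P:\bigvee_{i\in I}\mathsf p!\ell_i(S_i).T_i$, then for any participant $\mathsf q$ we have $\mathsf q\lhd P\longrightarrow^*\mathsf q\lhd\mathsf p!\ell_j(e).Q$ for some $j\in I$, expression $e$ and process $Q$.
   Context: Values: natural numbers $n$, integers $i$, $\mathsf{true},\mathsf{false}$. Expressions: $e::=x\mid v\mid \mathsf{succ}\,e\mid \mathsf{neg}\,e\mid \neg e\mid e_1\oplus e_2\mid e_1>e_2$. Evaluation $e\downarrow v$ is the least relation with: $\mathsf{succ}\,n\downarrow n+1$ (naturals only); $\mathsf{neg}\,i\downarrow -i$; $\neg\mathsf{true}\downarrow\mathsf{false}$, $\neg\mathsf{false}\downarrow\mathsf{true}$; $v\downarrow v$; $(i_1>i_2)\downarrow\mathsf{true}$ if $i_1>i_2$, else $\downarrow\mathsf{false}$; $e_1\oplus e_2\downarrow v$ if $e_1\downarrow v$ or $e_2\downarrow v$; $e\downarrow v$ and $\mathcal E(v)\downarrow v'$ imply $\mathcal E(e)\downarrow v'$ ($\mathcal E$ a one-hole expression context). Processes: $P::=\mathsf p?\ell(x).P\mid \mathsf p!\ell(e).P\mid P+P\mid \mathsf{if}\ e\ \mathsf{then}\ P\ \mathsf{else}\ P\mid \mu X.P\mid X\mid \mathbf 0$ (guarded recursion; $\mu X.P$ identified with its unfolding); $\sum$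 is iterated $+$, which is taken up to commutativity and associativity. Sessions $\mathcal M::=\mathsf p\lhd P\mid\mathcal M\mid\mathcal M$. Reductions relevant here: $\mathsf p\lhd\mathsf{if}\ e\ \mathsf{then}\ P\ \mathsf{else}\ Q\longrightarrow\mathsf p\lhd P$ if $e\downarrow\mathsf{true}$ and $\longrightarrow\mathsf p\lhd Q$ if $e\downarrow\mathsf{false}$ (the full reduction also has the communication rule $\mathsf p\lhd\sum_{i\in I}\mathsf q?\ell_i(x).P_i\mid\mathsf q\lhd\mathsf p!\ell_j(e).Q\longrightarrow\mathsf p\lhd P_j\{v/x\}\mid\mathsf q\lhd Q$ for $j\in I$, $e\downarrow v$, closure under parallel contexts and structural congruence); $\longrightarrow^*$ is reflexive-transitive closure. Sorts $\mathtt{nat},\mathtt{int},\mathtt{bool}$, $\leq:$ the reflexive-transitive closure of $\mathtt{nat}\leq:\mathtt{int}$. Session types $T::=\bigwedge_{i\in I}\mathsf p?\ell_i(S_i).T_i\mid\bigvee_{i\in I}\mathsf q!\ell_i(S_i).T_i\mid\mu\mathbf t.T\mid\mathbf t\mid\mathtt{end}$ (distinct labels, guarded recursion, regular-tree equality). Subtyping $\leqslant$: greatest relation with $\mathtt{end}\leqslant\mathtt{end}$; $\bigwedge_{i\in I\cup J}\mathsf p?\ell_i(S_i).T_i\leqslant\bigwedge_{i\in I}\mathsf p?\ell_i(S'_i).T'_i$ if $S'_i\leq:S_i$, $T_i\leqslant T'_i$ ($i\in I$); $\bigvee_{i\in I}\mathsf p!\ell_i(S_i).T_i\leqslant\bigvee_{i\in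 I\cup J}\mathsf p!\ell_i(S'_i).T'_i$ if $S_i\leq:S'_i$, $T_i\leqslant T'_i$ ($i\in I$). Typing: expressions: $n:\mathtt{nat}$, $i:\mathtt{int}$, booleans $:\mathtt{bool}$, $\Gamma,x:S\vdash x:S$; $\mathsf{succ}$: $\mathtt{nat}\to\mathtt{nat}$; $\mathsf{neg}$: $\mathtt{int}\to\mathtt{int}$; $\neg$: $\mathtt{bool}\to\mathtt{bool}$; $e_1\oplus e_2:S$ if both $:S$; $e_1>e_2:\mathtt{bool}$ if both $:\mathtt{int}$; subsumption via $\leq:$. Processes: if $\Gamma,x:S_i\vdash P_i:T_i$ ($i\in I$) then $\Gamma\vdash\sum_{i\in I}\mathsf q?\ell_i(x).P_i:\bigwedge_{i\in I}\mathsf q?\ell_i(S_i).T_i$; $\Gamma\vdash\mathbf 0:\mathtt{end}$; $\Gamma\vdash e:S$, $\Gamma\vdash P:T$ give $\Gamma\vdash\mathsf q!\ell(e).P:\mathsf q!\ell(S).T$; $\Gamma\vdash e:\mathtt{bool}$, $\Gamma\vdash P_1:T_1$, $\Gamma\vdash P_2:T_2$ give $\Gamma\vdash\mathsf{if}\ e\ \mathsf{then}\ P_1\ \mathsf{else}\ P_2:T_1\vee T_2$; $\Gamma,X:T\vdash P:T$ gives $\Gamma\vdash\mu X.P:T$; $\Gamma,X:T\vdash X:T$; $\Gamma\vdash P:T$ and $T\leqslant T'$ give $\Gamma\vdash P:T'$. $\vdash P:T$ denotes typing in the empty environment. -}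

module Defs where

open import Level using (Level) renaming (suc to lsuc; zero to lzero)
open import Data.Nat using (ℕ; zero; suc; _≟_)
open import Data.Integer using (ℤ; +_; -_; _<_)
open import Data.Bool using (Bool; true; false; if_then_else_)
open import Data.Product using (Σ; _×_; _,_; proj₁; proj₂)
open import Data.Sum using (_⊎_)
open import Data.Unit using (⊤)
open import Data.Empty using (⊥)
open import Data.List using (List; []; _∷_; map)
open import Data.List.Membership.Propositional using (_∈_)
open import Data.List.Relation.Unary.Unique.Propositional using (Unique)
open import Relation.Nullary using (¬_; does)
open import Relation.Binary.PropositionalEquality using (_≡_; _≢_)

Role : Set
Role = ℕ

Label : Set
Label = ℕ

Var : Set
Var = ℕ

-- Values and expressions.
-- Naturals are the non-negative integers (so a natural n is also an
-- integer, matching nat <: int); booleans are separate values.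

data Val : Set where
  num  : ℤ → Val
  bool : Bool → Val

data Expr : Set where
  var  : Var → Expr
  val  : Val → Expr
  succ : Expr → Expr
  neg  : Expr → Expr
  not  : Expr → Expr
  _⊕_  : Expr → Expr → Expr
  _>ₑ_ : Expr → Expr → Expr

data ECtx : Set where
  hole  : ECtx
  succC : ECtx → ECtx
  negC  : ECtx → ECtx
  notC  : ECtx → ECtx
  ⊕L    : ECtx → Expr → ECtx
  ⊕R    : Expr → ECtx → ECtx
  >L    : ECtx → Expr → ECtx
  >R    : Expr → ECtx → ECtx

plug : ECtx → Expr → Expr
plug hole     e = e
plug (succC E) e = succ (plug E e)
plug (negC E)  e = neg (plug E e)
plug (notC E)  e = not (plug E e)
plug (⊕L E e₂) e = plug E e ⊕ e₂
plug (⊕R e₁ E) e = e₁ ⊕ plug E e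
plug (>L E e₂) e = plug E e >ₑ e₂
plug (>R e₁ E) e = e₁ >ₑ plug E e

data _↓_ : Expr → Val → Set where
  ev-succ  : ∀ n → succ (val (num (+ n))) ↓ num (+ (suc n))
  ev-neg   : ∀ i → neg (val (num i)) ↓ num (- i)
  ev-nott  : not (val (bool true)) ↓ bool false
  ev-notf  : not (val (bool false)) ↓ bool true
  ev-val   : ∀ v → val v ↓ v
  ev-gtt   : ∀ {i j} → j < i → (val (num i) >ₑ val (num j)) ↓ bool true
  ev-gtf   : ∀ {i j} → ¬ (j < i) → (val (num i) >ₑ val (num j)) ↓ bool false
  ev-⊕L    : ∀ {e₁ e₂ v} → e₁ ↓ v → (e₁ ⊕ e₂) ↓ v
  ev-⊕R    : ∀ {e₁ e₂ v} → e₂ ↓ v → (e₁ ⊕ e₂) ↓ v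
  ev-ctx   : ∀ {E e v v'} → e ↓ v → plug E (val v) ↓ v' → plug E e ↓ v'

data Sort : Set where
  nat int bool : Sort

data _≤:_ : Sort → Sort → Set where
  ≤:-refl : ∀ {S} → S ≤: S
  nat≤:int : nat ≤: int

-- Processes.  Process variables are de Bruijn indices (μ binds index 0);
-- expression variables are names.

data Proc : Set where
  inp  : Role → Label → Var → Proc → Proc
  out  : Role → Label → Expr → Proc → Proc
  _+ₚ_ : Proc → Proc → Proc
  ite  : Expr → Proc → Proc → Proc
  rec  : Proc → Proc
  pvar : ℕ → Proc
  nil  : Proc

extR : (ℕ → ℕ) → ℕ → ℕ
extR ρ zero    = zero
extR ρ (suc n) = suc (ρ n)

renP : (ℕ → ℕ) → Proc → Proc
renP ρ (inp p ℓ x P) = inp p ℓ x (renP ρ P)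
renP ρ (out p ℓ e P) = out p ℓ e (renP ρ P)
renP ρ (P +ₚ Q)      = renP ρ P +ₚ renP ρ Q
renP ρ (ite e P Q)   = ite e (renP ρ P) (renP ρ Q)
renP ρ (rec P)       = rec (renP (extR ρ) P)
renP ρ (pvar n)      = pvar (ρ n)
renP ρ nil           = nil

extSP : (ℕ → Proc) → ℕ → Proc
extSP σ zero    = pvar zero
extSP σ (suc n) = renP suc (σ n)

substP : (ℕ → Proc) → Proc → Proc
substP σ (inp p ℓ x P) = inp p ℓ x (substP σ P)
substP σ (out p ℓ e P) = out p ℓ e (substP σ P)
substP σ (P +ₚ Q)      = substP σ P +ₚ substP σ Q
substP σ (ite e P Q)   = ite e (substP σ P) (substP σ Q)
substP σ (rec P)       = rec (substP (extSP σ) P)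
substP σ (pvar n)      = σ n
substP σ nil           = nil

sub0P : Proc → ℕ → Proc
sub0P Q zero    = Q
sub0P Q (suc n) = pvar n

unfoldP : Proc → Proc
unfoldP P = substP (sub0P (rec P)) P

substE : Var → Val → Expr → Expr
substE x v (var y)    = if does (x ≟ y) then val v else var y
substE x v (val w)    = val w
substE x v (succ e)   = succ (substE x v e)
substE x v (neg e)    = neg (substE x v e)
substE x v (not e)    = not (substE x v e)
substE x v (e₁ ⊕ e₂)  = substE x v e₁ ⊕ substE x v e₂
substE x v (e₁ >ₑ e₂) = substE x v e₁ >ₑ substE x v e₂

substV : Var → Val → Proc → Proc
substV x v (inp p ℓ y P) = if does (x ≟ y) then inp p ℓ y P else inp p ℓ y (substV x v P)
substV x v (out p ℓ e P) = out p ℓ (substE x v e) (substV x v P)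
substV x v (P +ₚ Q)      = substV x v P +ₚ substV x v Q
substV x v (ite e P Q)   = ite (substE x v e) (substV x v P) (substV x v Q)
substV x v (rec P)       = rec (substV x v P)
substV x v (pvar n)      = pvar n
substV x v nil           = nil

GuardedP : ℕ → Proc → Set
GuardedP n (inp p ℓ x P) = ⊤
GuardedP n (out p ℓ e P) = ⊤
GuardedP n (P +ₚ Q)      = GuardedP n P × GuardedP n Q
GuardedP n (ite e P Q)   = GuardedP n P × GuardedP n Q
GuardedP n (rec P)       = GuardedP (suc n) P
GuardedP n (pvar m)      = m ≢ n
GuardedP n nil           = ⊤

infix 4 _≅_
data _≅_ : Proc → Proc → Set where
  ≅-refl   : ∀ {P} → P ≅ P
  ≅-sym    : ∀ {P Q} → P ≅ Q → Q ≅ P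
  ≅-trans  : ∀ {P Q R} → P ≅ Q → Q ≅ R → P ≅ R
  ≅-unfold : ∀ {P} → rec P ≅ unfoldP P
  ≅-comm   : ∀ {P Q} → (P +ₚ Q) ≅ (Q +ₚ P)
  ≅-assoc  : ∀ {P Q R} → ((P +ₚ Q) +ₚ R) ≅ (P +ₚ (Q +ₚ R))
  ≅-inp    : ∀ {p ℓ x P Q} → P ≅ Q → inp p ℓ x P ≅ inp p ℓ x Q
  ≅-out    : ∀ {p ℓ e P Q} → P ≅ Q → out p ℓ e P ≅ out p ℓ e Q
  ≅-sum    : ∀ {P P' Q Q'} → P ≅ P' → Q ≅ Q' → (P +ₚ Q) ≅ (P' +ₚ Q')
  ≅-ite    : ∀ {e P P' Q Q'} → P ≅ P' → Q ≅ Q' → ite e P Q ≅ ite e P' Q'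
  ≅-rec    : ∀ {P Q} → P ≅ Q → rec P ≅ rec Q

IBr : Set
IBr = Label × Var × Proc

data InputSum (q : Role) : Proc → List IBr → Set where
  is-one : ∀ {ℓ x P} → InputSum q (inp q ℓ x P) ((ℓ , x , P) ∷ [])
  is-sum : ∀ {P Q bs cs} → InputSum q P bs → InputSum q Q cs →
           InputSum q (P +ₚ Q) (bs Data.List.++ cs)

data Session : Set where
  _◁_ : Role → Proc → Session
  _∥_ : Session → Session → Session

infix 4 _≡ₛ_
data _≡ₛ_ : Session → Session → Set where
  ≡ₛ-refl  : ∀ {M} → M ≡ₛ M
  ≡ₛ-sym   : ∀ {M N} → M ≡ₛ N → N ≡ₛ M
  ≡ₛ-trans : ∀ {M N L} → M ≡ₛ N → N ≡ₛ L → M ≡ₛ L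
  ≡ₛ-comm  : ∀ {M N} → (M ∥ N) ≡ₛ (N ∥ M)
  ≡ₛ-assoc : ∀ {M N L} → ((M ∥ N) ∥ L) ≡ₛ (M ∥ (N ∥ L))
  ≡ₛ-par   : ∀ {M M' N N'} → M ≡ₛ M' → N ≡ₛ N' → (M ∥ N) ≡ₛ (M' ∥ N')
  ≡ₛ-proc  : ∀ {p P Q} → P ≅ Q → (p ◁ P) ≡ₛ (p ◁ Q)
  ≡ₛ-nil   : ∀ {p M} → ((p ◁ nil) ∥ M) ≡ₛ M

infix 4 _⟶_
data _⟶_ : Session → Session → Set where
  r-comm  : ∀ {p q P bs ℓ x Pj e v Q} →
            InputSum q P bs → (ℓ , x , Pj) ∈ bs → e ↓ v →
            ((p ◁ P) ∥ (q ◁ out p ℓ e Q)) ⟶ ((p ◁ substV x v Pj) ∥ (q ◁ Q))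
  r-ift   : ∀ {p e P Q} → e ↓ bool true  → (p ◁ ite e P Q) ⟶ (p ◁ P)
  r-iff   : ∀ {p e P Q} → e ↓ bool false → (p ◁ ite e P Q) ⟶ (p ◁ Q)
  r-par   : ∀ {M M' N} → M ⟶ M' → (M ∥ N) ⟶ (M' ∥ N)
  r-struct : ∀ {M M' N N'} → M ≡ₛ M' → M' ⟶ N' → N' ≡ₛ N → M ⟶ N

-- Session types (syntax with de Bruijn type variables; μ binds 0)

mutual
  Br : Set
  Br = Label × Sort × Ty

  data Ty : Set where
    inT  : Role → List (Label × Sort × Ty) → Ty
    outT : Role → List (Label × Sort × Ty) → Ty
    muT  : Ty → Ty
    varT : ℕ → Ty
    endT : Ty

mutual
  renT : (ℕ → ℕ) → Ty → Ty
  renT ρ (inT p bs)  = inT p (renB ρ bs)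
  renT ρ (outT p bs) = outT p (renB ρ bs)
  renT ρ (muT T)     = muT (renT (extR ρ) T)
  renT ρ (varT n)    = varT (ρ n)
  renT ρ endT        = endT

  renB : (ℕ → ℕ) → List Br → List Br
  renB ρ [] = []
  renB ρ ((ℓ , S , T) ∷ bs) = (ℓ , S , renT ρ T) ∷ renB ρ bs

extST : (ℕ → Ty) → ℕ → Ty
extST σ zero    = varT zero
extST σ (suc n) = renT suc (σ n)

mutual
  substT : (ℕ → Ty) → Ty → Ty
  substT σ (inT p bs)  = inT p (substB σ bs)
  substT σ (outT p bs) = outT p (substB σ bs)
  substT σ (muT T)     = muT (substT (extST σ) T)
  substT σ (varT n)    = σ n
  substT σ endT        = endT

  substB : (ℕ → Ty) → List Br → List Br
  substB σ [] = []
  substB σ ((ℓ , S , T) ∷ bs) = (ℓ , S , substT σ T) ∷ substB σ bs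

sub0T : Ty → ℕ → Ty
sub0T U zero    = U
sub0T U (suc n) = varT n

unfoldT : Ty → Ty
unfoldT T = substT (sub0T (muT T)) T

mutual
  ClosedT : ℕ → Ty → Set
  ClosedT k (inT p bs)  = ClosedB k bs
  ClosedT k (outT p bs) = ClosedB k bs
  ClosedT k (muT T)     = ClosedT (suc k) T
  ClosedT k (varT n)    = Data.Nat._<_ n k
  ClosedT k endT        = ⊤

  ClosedB : ℕ → List Br → Set
  ClosedB k [] = ⊤
  ClosedB k ((ℓ , S , T) ∷ bs) = ClosedT k T × ClosedB k bs

NotVar : Ty → Set
NotVar (varT n) = ⊥
NotVar _        = ⊤

mutual
  GuardedT : Ty → Set
  GuardedT (inT p bs)  = GuardedB bs
  GuardedT (outT p bs) = GuardedB bs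
  GuardedT (muT T)     = NotVar T × GuardedT T
  GuardedT (varT n)    = ⊤
  GuardedT endT        = ⊤

  GuardedB : List Br → Set
  GuardedB [] = ⊤
  GuardedB ((ℓ , S , T) ∷ bs) = GuardedT T × GuardedB bs

labels : List Br → List Label
labels = map proj₁

mutual
  DistinctT : Ty → Set
  DistinctT (inT p bs)  = Unique (labels bs) × DistinctB bs
  DistinctT (outT p bs) = Unique (labels bs) × DistinctB bs
  DistinctT (muT T)     = DistinctT T
  DistinctT (varT n)    = ⊤
  DistinctT endT        = ⊤

  DistinctB : List Br → Set
  DistinctB [] = ⊤
  DistinctB ((ℓ , S , T) ∷ bs) = DistinctT T × DistinctB bs

WF : Ty → Set
WF T = ClosedT 0 T × GuardedT T × DistinctT T

data Unf : Ty → Ty → Set where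
  unf-in  : ∀ {p bs} → Unf (inT p bs) (inT p bs)
  unf-out : ∀ {p bs} → Unf (outT p bs) (outT p bs)
  unf-end : Unf endT endT
  unf-mu  : ∀ {T H} → Unf (unfoldT T) H → Unf (muT T) H

-- one step of the subtyping functional (on regular trees, i.e. up to unfolding)
SubF : (Ty → Ty → Set) → Ty → Ty → Set
SubF R T T' =
    (Unf T endT × Unf T' endT)
  ⊎ (Σ Role λ p → Σ (List Br) λ B → Σ (List Br) λ B' →
       Unf T (inT p B) × Unf T' (inT p B') ×
       (∀ {ℓ S' U'} → (ℓ , S' , U') ∈ B' →
          Σ Sort λ S → Σ Ty λ U → (ℓ , S , U) ∈ B × S' ≤: S × R U U'))
  ⊎ (Σ Role λ p → Σ (List Br) λ B → Σ (List Br) λ B' →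
       Unf T (outT p B) × Unf T' (outT p B') ×
       (∀ {ℓ S U} → (ℓ , S , U) ∈ B →
          Σ Sort λ S' → Σ Ty λ U' → (ℓ , S' , U') ∈ B' × S ≤: S' × R U U'))

-- subtyping: the greatest relation closed backwards under SubF
-- (T ⩽ T' iff (T,T') lies in some post-fixed point of SubF)
infix 4 _⩽_
_⩽_ : Ty → Ty → Set₁
T ⩽ T' = Σ (Ty → Ty → Set) λ R → R T T' × (∀ {A B} → R A B → SubF R A B)

data Join : Ty → Ty → Ty → Set where
  join : ∀ {p B₁ B₂ B} → Unique (labels B) →
         (∀ {b} → b ∈ B → b ∈ B₁ ⊎ b ∈ B₂) →
         (∀ {b} → b ∈ B₁ → b ∈ B) → (∀ {b} → b ∈ B₂ → b ∈ B) →
         Join (outT p B₁) (outT p B₂) (outT p B)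

ECtxT : Set
ECtxT = List (Var × Sort)

-- x : S in Γ (most recent binding of x)
data _∋_⦂_ : ECtxT → Var → Sort → Set where
  here  : ∀ {Γ x S} → ((x , S) ∷ Γ) ∋ x ⦂ S
  there : ∀ {Γ x y S S'} → x ≢ y → Γ ∋ x ⦂ S → ((y , S') ∷ Γ) ∋ x ⦂ S

data _⊢ₑ_⦂_ (Γ : ECtxT) : Expr → Sort → Set where
  t-nat  : ∀ n → Γ ⊢ₑ val (num (+ n)) ⦂ nat
  t-int  : ∀ i → Γ ⊢ₑ val (num i) ⦂ int
  t-bool : ∀ b → Γ ⊢ₑ val (bool b) ⦂ bool
  t-var  : ∀ {x S} → Γ ∋ x ⦂ S → Γ ⊢ₑ var x ⦂ S
  t-succ : ∀ {e} → Γ ⊢ₑ e ⦂ nat → Γ ⊢ₑ succ e ⦂ nat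
  t-neg  : ∀ {e} → Γ ⊢ₑ e ⦂ int → Γ ⊢ₑ neg e ⦂ int
  t-not  : ∀ {e} → Γ ⊢ₑ e ⦂ bool → Γ ⊢ₑ not e ⦂ bool
  t-⊕    : ∀ {e₁ e₂ S} → Γ ⊢ₑ e₁ ⦂ S → Γ ⊢ₑ e₂ ⦂ S → Γ ⊢ₑ (e₁ ⊕ e₂) ⦂ S
  t-gt   : ∀ {e₁ e₂} → Γ ⊢ₑ e₁ ⦂ int → Γ ⊢ₑ e₂ ⦂ int → Γ ⊢ₑ (e₁ >ₑ e₂) ⦂ bool
  t-subs : ∀ {e S S'} → Γ ⊢ₑ e ⦂ S → S ≤: S' → Γ ⊢ₑ e ⦂ S'

data _∋ₚ_⦂_ : List Ty → ℕ → Ty → Set where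
  here  : ∀ {Δ T} → (T ∷ Δ) ∋ₚ zero ⦂ T
  there : ∀ {Δ n T T'} → Δ ∋ₚ n ⦂ T → (T' ∷ Δ) ∋ₚ suc n ⦂ T

mutual
  data _︔_⊢_⦂_ (Γ : ECtxT) (Δ : List Ty) : Proc → Ty → Set₁ where
    t-inp  : ∀ {q P bs tbs} → InputSum q P bs → BranchesT Γ Δ bs tbs →
             Unique (labels tbs) → Γ ︔ Δ ⊢ P ⦂ inT q tbs
    t-nil  : Γ ︔ Δ ⊢ nil ⦂ endT
    t-out  : ∀ {q ℓ e P S T} → Γ ⊢ₑ e ⦂ S → Γ ︔ Δ ⊢ P ⦂ T →
             Γ ︔ Δ ⊢ out q ℓ e P ⦂ outT q ((ℓ , S , T) ∷ [])
    t-ite  : ∀ {e P₁ P₂ T₁ T₂ T} → Γ ⊢ₑ e ⦂ bool → Γ ︔ Δ ⊢ P₁ ⦂ T₁ →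
             Γ ︔ Δ ⊢ P₂ ⦂ T₂ → Join T₁ T₂ T → Γ ︔ Δ ⊢ ite e P₁ P₂ ⦂ T
    t-rec  : ∀ {P T} → WF T → GuardedP zero P → Γ ︔ (T ∷ Δ) ⊢ P ⦂ T →
             Γ ︔ Δ ⊢ rec P ⦂ T
    t-var  : ∀ {n T} → Δ ∋ₚ n ⦂ T → Γ ︔ Δ ⊢ pvar n ⦂ T
    t-sub  : ∀ {P T T'} → Γ ︔ Δ ⊢ P ⦂ T → T ⩽ T' → WF T' → Γ ︔ Δ ⊢ P ⦂ T'

  data BranchesT (Γ : ECtxT) (Δ : List Ty) : List IBr → List Br → Set₁ where
    []  : BranchesT Γ Δ [] []
    _∷_ : ∀ {ℓ x P S T bs tbs} → ((x , S) ∷ Γ) ︔ Δ ⊢ P ⦂ T →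
          BranchesT Γ Δ bs tbs → BranchesT Γ Δ ((ℓ , x , P) ∷ bs) ((ℓ , S , T) ∷ tbs)

⊢_⦂_ : Proc → Ty → Set₁
⊢ P ⦂ T = [] ︔ [] ⊢ P ⦂ T

-- A process is canonical for a type when, if the type unfolds to an input
-- from p, the process is (up to ≅) an input sum from p covering all of its
-- labels, and, if the type unfolds to an output to p, the process reaches an
-- output to p on one of its labels by evaluating conditionals.  Canonicity is
-- preserved by subtyping and by every typing rule.  For μX.P the hypothesis
-- about X would be circular, but guardedness keeps X out of head position, so
-- it is only ever needed for the free variables below the μ, which are
-- substituted by processes already known to be canonical.
module Submission where

open import Defs
open import Data.Product using (Σ; _×_; _,_; proj₁; proj₂)
open import Data.List using (List; []; _∷_; map)
open import Data.List.Membership.Propositional using (_∈_)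
open import Data.List.Relation.Unary.All using (All)
open import Relation.Binary.Construct.Closure.ReflexiveTransitive using (Star; ε; _◅_)
open import Function using (_∘_)
open import Data.Nat using (ℕ; zero; suc)
open import Data.Integer using (+_)
open import Data.Integer.Properties using (_<?_)
open import Data.Bool using (Bool; true; false)
open import Data.Sum using (inj₁; inj₂)
open import Data.Empty using (⊥; ⊥-elim)
open import Data.List.Properties using (map-++; map-∘)
open import Data.List.Relation.Unary.Any using (here; there)
import Data.List.Relation.Unary.All as All
open import Relation.Nullary using (yes; no)
open import Relation.Binary.PropositionalEquality
  using (_≡_; refl; sym; trans; cong; cong₂; subst)

renP-cong : ∀ {ρ ρ'} → (∀ n → ρ n ≡ ρ' n) → ∀ P → renP ρ P ≡ renP ρ' P
renP-cong h (inp p ℓ x P) = cong (inp p ℓ x) (renP-cong h P)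
renP-cong h (out p ℓ e P) = cong (out p ℓ e) (renP-cong h P)
renP-cong h (P +ₚ Q)      = cong₂ _+ₚ_ (renP-cong h P) (renP-cong h Q)
renP-cong h (ite e P Q)   = cong₂ (ite e) (renP-cong h P) (renP-cong h Q)
renP-cong h (rec P)       = cong rec (renP-cong (λ { zero → refl ; (suc n) → cong suc (h n) }) P)
renP-cong h (pvar n)      = cong pvar (h n)
renP-cong h nil           = refl

substP-cong : ∀ {σ τ} → (∀ n → σ n ≡ τ n) → ∀ P → substP σ P ≡ substP τ P
substP-cong h (inp p ℓ x P) = cong (inp p ℓ x) (substP-cong h P)
substP-cong h (out p ℓ e P) = cong (out p ℓ e) (substP-cong h P)
substP-cong h (P +ₚ Q)      = cong₂ _+ₚ_ (substP-cong h P) (substP-cong h Q)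
substP-cong h (ite e P Q)   = cong₂ (ite e) (substP-cong h P) (substP-cong h Q)
substP-cong h (rec P)       =
  cong rec (substP-cong (λ { zero → refl ; (suc n) → cong (renP suc) (h n) }) P)
substP-cong h (pvar n)      = h n
substP-cong h nil           = refl

substP-id : ∀ P → substP pvar P ≡ P
substP-id (inp p ℓ x P) = cong (inp p ℓ x) (substP-id P)
substP-id (out p ℓ e P) = cong (out p ℓ e) (substP-id P)
substP-id (P +ₚ Q)      = cong₂ _+ₚ_ (substP-id P) (substP-id Q)
substP-id (ite e P Q)   = cong₂ (ite e) (substP-id P) (substP-id Q)
substP-id (rec P)       =
  cong rec (trans (substP-cong (λ { zero → refl ; (suc n) → refl }) P) (substP-id P))
substP-id (pvar n)      = refl
substP-id nil           = refl

renP-renP : ∀ ρ ρ' P → renP ρ (renP ρ' P) ≡ renP (ρ ∘ ρ') P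
renP-renP ρ ρ' (inp p ℓ x P) = cong (inp p ℓ x) (renP-renP ρ ρ' P)
renP-renP ρ ρ' (out p ℓ e P) = cong (out p ℓ e) (renP-renP ρ ρ' P)
renP-renP ρ ρ' (P +ₚ Q)      = cong₂ _+ₚ_ (renP-renP ρ ρ' P) (renP-renP ρ ρ' Q)
renP-renP ρ ρ' (ite e P Q)   = cong₂ (ite e) (renP-renP ρ ρ' P) (renP-renP ρ ρ' Q)
renP-renP ρ ρ' (rec P)       = cong rec (trans (renP-renP (extR ρ) (extR ρ') P)
                                               (renP-cong (λ { zero → refl ; (suc n) → refl }) P))
renP-renP ρ ρ' (pvar n)      = refl
renP-renP ρ ρ' nil           = refl

substP-renP : ∀ τ ρ P → substP τ (renP ρ P) ≡ substP (τ ∘ ρ) P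
substP-renP τ ρ (inp p ℓ x P) = cong (inp p ℓ x) (substP-renP τ ρ P)
substP-renP τ ρ (out p ℓ e P) = cong (out p ℓ e) (substP-renP τ ρ P)
substP-renP τ ρ (P +ₚ Q)      = cong₂ _+ₚ_ (substP-renP τ ρ P) (substP-renP τ ρ Q)
substP-renP τ ρ (ite e P Q)   = cong₂ (ite e) (substP-renP τ ρ P) (substP-renP τ ρ Q)
substP-renP τ ρ (rec P)       = cong rec (trans (substP-renP (extSP τ) (extR ρ) P)
                                                (substP-cong (λ { zero → refl ; (suc n) → refl }) P))
substP-renP τ ρ (pvar n)      = refl
substP-renP τ ρ nil           = refl

renP-substP : ∀ ρ σ P → renP ρ (substP σ P) ≡ substP (renP ρ ∘ σ) P
renP-substP ρ σ (inp p ℓ x P) = cong (inp p ℓ x) (renP-substP ρ σ P)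
renP-substP ρ σ (out p ℓ e P) = cong (out p ℓ e) (renP-substP ρ σ P)
renP-substP ρ σ (P +ₚ Q)      = cong₂ _+ₚ_ (renP-substP ρ σ P) (renP-substP ρ σ Q)
renP-substP ρ σ (ite e P Q)   = cong₂ (ite e) (renP-substP ρ σ P) (renP-substP ρ σ Q)
renP-substP ρ σ (rec P)       = cong rec (trans (renP-substP (extR ρ) (extSP σ) P) (substP-cong h P))
  where
  h : ∀ n → renP (extR ρ) (extSP σ n) ≡ extSP (renP ρ ∘ σ) n
  h zero    = refl
  h (suc n) = trans (renP-renP (extR ρ) suc (σ n)) (sym (renP-renP suc ρ (σ n)))
renP-substP ρ σ (pvar n)      = refl
renP-substP ρ σ nil           = refl

substP-substP : ∀ τ σ P → substP τ (substP σ P) ≡ substP (substP τ ∘ σ) P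
substP-substP τ σ (inp p ℓ x P) = cong (inp p ℓ x) (substP-substP τ σ P)
substP-substP τ σ (out p ℓ e P) = cong (out p ℓ e) (substP-substP τ σ P)
substP-substP τ σ (P +ₚ Q)      = cong₂ _+ₚ_ (substP-substP τ σ P) (substP-substP τ σ Q)
substP-substP τ σ (ite e P Q)   = cong₂ (ite e) (substP-substP τ σ P) (substP-substP τ σ Q)
substP-substP τ σ (rec P)       = cong rec (trans (substP-substP (extSP τ) (extSP σ) P) (substP-cong h P))
  where
  h : ∀ n → substP (extSP τ) (extSP σ n) ≡ extSP (substP τ ∘ σ) n
  h zero    = refl
  h (suc n) = trans (substP-renP (extSP τ) suc (σ n)) (sym (renP-substP suc τ (σ n)))
substP-substP τ σ (pvar n)      = refl
substP-substP τ σ nil           = refl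

_∷ₛ_ : Proc → (ℕ → Proc) → ℕ → Proc
(X ∷ₛ σ) zero    = X
(X ∷ₛ σ) (suc n) = σ n

unfoldP-substP : ∀ σ P →
  unfoldP (substP (extSP σ) P) ≡ substP (rec (substP (extSP σ) P) ∷ₛ σ) P
unfoldP-substP σ P = trans (substP-substP (sub0P X) (extSP σ) P) (substP-cong h P)
  where
  X = rec (substP (extSP σ) P)
  h : ∀ n → substP (sub0P X) (extSP σ n) ≡ (X ∷ₛ σ) n
  h zero    = refl
  h (suc n) = trans (substP-renP (sub0P X) suc (σ n)) (substP-id (σ n))

substBr : (ℕ → Proc) → IBr → IBr
substBr σ (ℓ , x , P) = ℓ , x , substP σ P

InputSum-substP : ∀ {q P bs} σ → InputSum q P bs → InputSum q (substP σ P) (map (substBr σ) bs)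
InputSum-substP σ is-one = is-one
InputSum-substP σ (is-sum {bs = bs} {cs} a b) rewrite map-++ (substBr σ) bs cs =
  is-sum (InputSum-substP σ a) (InputSum-substP σ b)

BranchesT-labels : ∀ {Γ Δ bs tbs} → BranchesT Γ Δ bs tbs →
  All (λ b → proj₁ b ∈ map proj₁ bs) tbs
BranchesT-labels []       = All.[]
BranchesT-labels (_ ∷ ds) = here refl All.∷ All.map there (BranchesT-labels ds)

data _∶ᵥ_ : Val → Sort → Set where
  nat  : ∀ n → num (+ n) ∶ᵥ nat
  int  : ∀ i → num i ∶ᵥ int
  bool : ∀ b → bool b ∶ᵥ bool

∶ᵥ-≤: : ∀ {v S S'} → v ∶ᵥ S → S ≤: S' → v ∶ᵥ S'
∶ᵥ-≤: v ≤:-refl        = v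
∶ᵥ-≤: (nat n) nat≤:int = int (+ n)

⊢ₑ-evaluates : ∀ {e S} → [] ⊢ₑ e ⦂ S → Σ Val λ v → e ↓ v × v ∶ᵥ S
⊢ₑ-evaluates (t-nat n)  = _ , ev-val _ , nat n
⊢ₑ-evaluates (t-int i)  = _ , ev-val _ , int i
⊢ₑ-evaluates (t-bool b) = _ , ev-val _ , bool b
⊢ₑ-evaluates (t-var ())
⊢ₑ-evaluates (t-succ d) with ⊢ₑ-evaluates d
... | _ , ev , nat n = _ , ev-ctx {E = succC hole} ev (ev-succ n) , nat (suc n)
⊢ₑ-evaluates (t-neg d) with ⊢ₑ-evaluates d
... | _ , ev , int i = _ , ev-ctx {E = negC hole} ev (ev-neg i) , int _
⊢ₑ-evaluates (t-not d) with ⊢ₑ-evaluates d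
... | _ , ev , bool true  = _ , ev-ctx {E = notC hole} ev ev-nott , bool false
... | _ , ev , bool false = _ , ev-ctx {E = notC hole} ev ev-notf , bool true
⊢ₑ-evaluates (t-⊕ d₁ _) with ⊢ₑ-evaluates d₁
... | v , ev , s = v , ev-⊕L ev , s
⊢ₑ-evaluates (t-gt {e₂ = e₂} d₁ d₂) with ⊢ₑ-evaluates d₁ | ⊢ₑ-evaluates d₂
... | _ , ev₁ , int i | _ , ev₂ , int j =
  _ , ev-ctx {E = >L hole e₂} ev₁ (ev-ctx {E = >R (val (num i)) hole} ev₂ (proj₂ compare)) , bool _
  where
  compare : Σ Bool λ b → (val (num i) >ₑ val (num j)) ↓ bool b
  compare with j <? i
  ... | yes j<i = true  , ev-gtt j<i
  ... | no  j≮i = false , ev-gtf j≮i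
⊢ₑ-evaluates (t-subs d S≤:S') with ⊢ₑ-evaluates d
... | v , ev , s = v , ev , ∶ᵥ-≤: s S≤:S'

data Unguarded : ℕ → Proc → Set where
  pvar : ∀ {n} → Unguarded n (pvar n)
  +ₚˡ  : ∀ {n P Q} → Unguarded n P → Unguarded n (P +ₚ Q)
  +ₚʳ  : ∀ {n P Q} → Unguarded n Q → Unguarded n (P +ₚ Q)
  iteˡ : ∀ {n e P Q} → Unguarded n P → Unguarded n (ite e P Q)
  iteʳ : ∀ {n e P Q} → Unguarded n Q → Unguarded n (ite e P Q)
  rec  : ∀ {n P} → Unguarded (suc n) P → Unguarded n (rec P)

GuardedP⇒¬Unguarded : ∀ {n P} → GuardedP n P → Unguarded n P → ⊥
GuardedP⇒¬Unguarded n≢n     pvar     = n≢n refl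
GuardedP⇒¬Unguarded (g , _) (+ₚˡ u)  = GuardedP⇒¬Unguarded g u
GuardedP⇒¬Unguarded (_ , g) (+ₚʳ u)  = GuardedP⇒¬Unguarded g u
GuardedP⇒¬Unguarded (g , _) (iteˡ u) = GuardedP⇒¬Unguarded g u
GuardedP⇒¬Unguarded (_ , g) (iteʳ u) = GuardedP⇒¬Unguarded g u
GuardedP⇒¬Unguarded g       (rec u)  = GuardedP⇒¬Unguarded g u

Unf-functional : ∀ {T H H'} → Unf T H → Unf T H' → H ≡ H'
Unf-functional unf-in     unf-in      = refl
Unf-functional unf-out    unf-out     = refl
Unf-functional unf-end    unf-end     = refl
Unf-functional (unf-mu u) (unf-mu u') = Unf-functional u u'

_⊆ₗ_ : List Br → List Br → Set
B ⊆ₗ B' = ∀ {ℓ S T} → (ℓ , S , T) ∈ B → Σ Sort λ S' → Σ Ty λ T' → (ℓ , S' , T') ∈ B'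

⊆⇒⊆ₗ : ∀ {B B'} → (∀ {b} → b ∈ B → b ∈ B') → B ⊆ₗ B'
⊆⇒⊆ₗ B⊆B' m = _ , _ , B⊆B' m

InputForm : Role → List Br → Proc → Set
InputForm p B R = Σ Proc λ Q → Σ (List IBr) λ bs →
  R ≅ Q × InputSum p Q bs × All (λ b → proj₁ b ∈ map proj₁ bs) B

ReachesOutput : Role → List Br → Role → Proc → Set
ReachesOutput p B q R = Σ Label λ ℓ → Σ Sort λ S → Σ Ty λ T →
  Σ Expr λ e → Σ Proc λ Q → Σ Proc λ R' →
    (ℓ , S , T) ∈ B × Star _⟶_ (q ◁ R) (q ◁ R') × R' ≅ out p ℓ e Q

Canonical : Proc → Ty → Set
Canonical R T =
  (∀ {p B} → Unf T (inT p B) → InputForm p B R) ×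
  (∀ {p B} → Unf T (outT p B) → ∀ q → ReachesOutput p B q R)

InputForm-≅ : ∀ {p B R R'} → R' ≅ R → InputForm p B R → InputForm p B R'
InputForm-≅ R'≅R (Q , bs , R≅Q , is , ls) = Q , bs , ≅-trans R'≅R R≅Q , is , ls

InputForm-⊇ : ∀ {p B B' R} → B' ⊆ₗ B → InputForm p B R → InputForm p B' R
InputForm-⊇ B'⊆B (Q , bs , R≅Q , is , ls) =
  Q , bs , R≅Q , is , All.tabulate (λ m → All.lookup ls (proj₂ (proj₂ (B'⊆B m))))

ReachesOutput-≅ : ∀ {p B q R R'} → R' ≅ R → ReachesOutput p B q R → ReachesOutput p B q R'
ReachesOutput-≅ R'≅R (ℓ , S , T , e , Q , R'' , m , ε , c) =
  ℓ , S , T , e , Q , _ , m , ε , ≅-trans R'≅R c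
ReachesOutput-≅ R'≅R (ℓ , S , T , e , Q , R'' , m , s ◅ ss , c) =
  ℓ , S , T , e , Q , R'' , m , r-struct (≡ₛ-proc R'≅R) s ≡ₛ-refl ◅ ss , c

ReachesOutput-◅ : ∀ {p B q R R'} → (q ◁ R) ⟶ (q ◁ R') →
  ReachesOutput p B q R' → ReachesOutput p B q R
ReachesOutput-◅ s (ℓ , S , T , e , Q , R'' , m , ss , c) = ℓ , S , T , e , Q , R'' , m , s ◅ ss , c

ReachesOutput-⊆ : ∀ {p B B' q R} → B ⊆ₗ B' → ReachesOutput p B q R → ReachesOutput p B' q R
ReachesOutput-⊆ B⊆B' (ℓ , S , T , e , Q , R' , m , ss , c) with B⊆B' m
... | S' , T' , m' = ℓ , S' , T' , e , Q , R' , m' , ss , c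

Canonical-≅ : ∀ {R R' T} → R' ≅ R → Canonical R T → Canonical R' T
Canonical-≅ R'≅R (inputs , outputs) =
  InputForm-≅ R'≅R ∘ inputs , λ u q → ReachesOutput-≅ R'≅R (outputs u q)

Canonical-outT : ∀ {R p B} → (∀ q → ReachesOutput p B q R) → Canonical R (outT p B)
Canonical-outT outputs = (λ ()) , λ { unf-out → outputs }

-- Subtyping only shrinks the branches of inputs and enlarges those of outputs,
-- which is the direction in which both halves of canonicity are preserved.
Canonical-⩽ : ∀ {R T T'} → Canonical R T → T ⩽ T' → Canonical R T'
Canonical-⩽ {R} {T} {T'} (inputs , outputs) (_ , r , post) = inputs' , outputs'
  where
  inputs' : ∀ {p B'} → Unf T' (inT p B') → InputForm p B' R
  inputs' u' with post r
  ... | inj₁ (_ , u'') with Unf-functional u'' u'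
  ...   | ()
  inputs' u' | inj₂ (inj₁ (_ , _ , _ , u , u'' , f)) with Unf-functional u'' u'
  ...   | refl = InputForm-⊇ (λ m → let (S , U , m' , _) = f m in S , U , m') (inputs u)
  inputs' u' | inj₂ (inj₂ (_ , _ , _ , _ , u'' , _)) with Unf-functional u'' u'
  ...   | ()
  outputs' : ∀ {p B'} → Unf T' (outT p B') → ∀ q → ReachesOutput p B' q R
  outputs' u' q with post r
  ... | inj₁ (_ , u'') with Unf-functional u'' u'
  ...   | ()
  outputs' u' q | inj₂ (inj₁ (_ , _ , _ , _ , u'' , _)) with Unf-functional u'' u'
  ...   | ()
  outputs' u' q | inj₂ (inj₂ (_ , _ , _ , u , u'' , f)) with Unf-functional u'' u'
  ...   | refl = ReachesOutput-⊆ (λ m → let (S , U , m' , _) = f m in S , U , m') (outputs u q)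

CanonicalEnv : (ℕ → Proc) → List Ty → Proc → Set
CanonicalEnv σ Δ P = ∀ {n U} → Δ ∋ₚ n ⦂ U → Unguarded n P → Canonical (σ n) U

canonical-substP : ∀ {Δ P T} → [] ︔ Δ ⊢ P ⦂ T → ∀ σ → CanonicalEnv σ Δ P →
  Canonical (substP σ P) T
canonical-substP (t-inp {P = P} {bs} is br _) σ _ =
  (λ { unf-in → substP σ P , map (substBr σ) bs , ≅-refl , InputSum-substP σ is ,
                 subst (λ ls → All (λ b → proj₁ b ∈ ls) _) (map-∘ bs) (BranchesT-labels br) }) ,
  λ ()
canonical-substP t-nil _ _ = (λ ()) , λ ()
canonical-substP (t-out _ _) _ _ = Canonical-outT λ _ → _ , _ , _ , _ , _ , _ , here refl , ε , ≅-refl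
canonical-substP (t-ite de d₁ d₂ (join _ _ B₁⊆B B₂⊆B)) σ env with ⊢ₑ-evaluates de
... | _ , ev , bool true  = Canonical-outT λ q → ReachesOutput-◅ (r-ift ev)
        (ReachesOutput-⊆ (⊆⇒⊆ₗ B₁⊆B) (proj₂ (canonical-substP d₁ σ (λ x → env x ∘ iteˡ)) unf-out q))
... | _ , ev , bool false = Canonical-outT λ q → ReachesOutput-◅ (r-iff ev)
        (ReachesOutput-⊆ (⊆⇒⊆ₗ B₂⊆B) (proj₂ (canonical-substP d₂ σ (λ x → env x ∘ iteʳ)) unf-out q))
canonical-substP (t-rec {P} {T} _ guarded d) σ env =
  Canonical-≅ ≅-unfold (subst (λ R → Canonical R T) (sym (unfoldP-substP σ P)) unfolded)
  where
  env' : CanonicalEnv (rec (substP (extSP σ) P) ∷ₛ σ) (T ∷ _) P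
  env' here      u = ⊥-elim (GuardedP⇒¬Unguarded guarded u)
  env' (there x) u = env x (rec u)
  unfolded : Canonical (substP (rec (substP (extSP σ) P) ∷ₛ σ) P) T
  unfolded = canonical-substP d _ env'
canonical-substP (t-var x) σ env = env x pvar
canonical-substP (t-sub d T⩽T' _) σ env = Canonical-⩽ (canonical-substP d σ env) T⩽T'

canonical : ∀ {P T} → ⊢ P ⦂ T → Canonical P T
canonical {P} {T} d = subst (λ R → Canonical R T) (substP-id P) (canonical-substP d pvar λ ())

mainTheorem8 :
    (∀ (P : Proc) (p : Role) (B : List Br) → WF (inT p B) → ⊢ P ⦂ inT p B →
       Σ Proc λ Q → Σ (List IBr) λ bs →
         P ≅ Q × InputSum p Q bs × All (λ b → proj₁ b ∈ map proj₁ bs) B)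
    ×
    (∀ (P : Proc) (p : Role) (B : List Br) → WF (outT p B) → ⊢ P ⦂ outT p B →
       ∀ (q : Role) → Σ Label λ ℓ → Σ Sort λ S → Σ Ty λ T →
         Σ Expr λ e → Σ Proc λ Q → Σ Proc λ P' →
           (ℓ , S , T) ∈ B × Star _⟶_ (q ◁ P) (q ◁ P') × P' ≅ out p ℓ e Q)
mainTheorem8 =
  (λ P p B _ d → proj₁ (canonical d) unf-in) ,
  (λ P p B _ d → proj₂ (canonical d) unf-out)
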